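{- Let $d \geq 1$ and let $\Delta = \Delta(\mathcal{X})$ be the earth mover's (EM) simplex on a family $\mathcal{X} = (X_0, \ldots, X_d)$ of finite sets. Then \[ {\rm Vol}(\Delta) = \frac{1}{d}\Bigg( {\rm Vol}_2(\Delta) + \sum_{\text{edges } \mathcal{E} \text{ of } \Delta} {\rm Vol}(\mathcal{E}) \Bigg), \] where the sum ranges over the $\binom{d+1}{2}$ edges $\mathcal{E}=\{X_i,X_j\}$, $0\le i<j\le d$.
   Context: Let $d \geq 0$ and $\mathcal{X} = (X_0, \ldots, X_d)$ a family of finite sets (repetitions allowed; vertices are indexed by $0,\dots,d$). Write $\cup\mathcal{X} = \bigcup_i X_i$ and, for $x \in \cup\mathcal{X}$, $\deg_{\mathcal{X}}(x) = \#\{i : x \in X_i\}$. Let ${\rm Min}(\mathcal{X}), {\rm Med}(\mathcal{X}), {\rm Maj}(\mathcal{X})$ be the sets of $x\in\cup\mathcal{X}$ with $\deg_{\mathcal{X}}(x) <, =, > (d+1)/2$ respectively. The abstract $d$-simplex $\Delta(\mathcal{X})$ has as faces all subsets $\mathcal{F}$ of the vertex set $\{X_0,\dots,X_d\}$ (including $\varnothing$), with $\dim\mathcal{F} = \#\mathcal{F}-1$; a cofacet of $\mathcal{F}$ is a face $\mathcal{G}\supset\mathcal{F}$ with $\#\mathcal{G}=\#\mathcal{F}+1$; edges are faces with two vertices. Define $\epsilon(x) = \{X_i : x \in X_i\}$ if $x \in {\rm Min}(\mathcal{X})\cup{\rm Med}(\mathcal{X})$ and $\epsilon(x) = \{X_i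 : x \notin X_i\}$ if $x\in{\rm Maj}(\mathcal{X})$; this is a face of dimension at most $\lfloor (d-1)/2\rfloor$. Define labelings: for faces $\mathcal{F}$ with $\dim \mathcal{F}\le\lfloor(d-1)/2\rfloor$, $\lambda^{(0)}(\mathcal{F}) = \{x \in\cup\mathcal{X} : \epsilon(x) = \mathcal{F}\}$; recursively, for faces $\mathcal{F}$ with $\dim\mathcal{F} \le \lfloor (d-1)/2\rfloor - (i+1)$, $\lambda^{(i+1)}(\mathcal{F})$ is the multiset union of $\lambda^{(i)}(\mathcal{G})$ over all cofacets $\mathcal{G}$ of $\mathcal{F}$. The EM simplex is $\Delta(\mathcal{X})$ equipped with these labelings. The $i$th generalized volume is ${\rm Vol}_i(\Delta) = \sum_{\mathcal{F}} |\lambda^{(i)}(\mathcal{F})|$ (multiset cardinalities), summed over faces with $\dim\mathcal{F}\le\lfloor(d-1)/2\rfloor - i$, and ${\rm Vol}(\Delta) = {\rm Vol}_1(\Delta)$. For a face $\mathcal{F}$, ${\rm Vol}(\mathcal{F})$ denotes the volume of the EM simplex on the subfamily $\mathcal{F}$ (so for an edge $\{X_i,X_j\}$ it equals $|X_i \triangle X_j|$). -}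

module Defs where

open import Data.Nat using (ℕ; zero; suc; _+_; _*_; _<ᵇ_; _≤ᵇ_; ⌊_/2⌋)
open import Data.Bool using (Bool; true; false; if_then_else_; not; _∧_)
import Data.Bool as B
open import Data.Fin using (Fin; zero; suc; toℕ)
open import Data.Fin.Subset using (Subset; inside; outside; ∣_∣)
open import Data.Vec using (Vec; []; _∷_; lookup; tabulate; _[_]≔_)
open import Data.Vec.Properties using (≡-dec)
open import Data.Nat.ListAction using (sum)
open import Data.List using (List; map; allFin; _++_) renaming ([] to []ₗ; _∷_ to _∷ₗ_)
open import Relation.Nullary using (does)

ΣFin : (m : ℕ) → (Fin m → ℕ) → ℕ
ΣFin m f = sum (map f (allFin m))

allSubsets : (m : ℕ) → List (Subset m)
allSubsets zero = [] ∷ₗ []ₗ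
allSubsets (suc m) = map (outside ∷_) (allSubsets m) ++ map (inside ∷_) (allSubsets m)

Family : ℕ → ℕ → Set
Family d n = Fin (suc d) → Subset n

module _ {d n : ℕ} (X : Family d n) where

  deg : Fin n → ℕ
  deg x = ΣFin (suc d) (λ i → if lookup (X i) x then 1 else 0)

  inUnion : Fin n → Bool
  inUnion x = 1 ≤ᵇ deg x

  -- x ∈ Maj(X)  iff  deg x > (d+1)/2  iff  d+1 < 2 deg x
  isMaj : Fin n → Bool
  isMaj x = suc d <ᵇ 2 * deg x

  ε : Fin n → Subset (suc d)
  ε x = tabulate (λ i → if isMaj x then not (lookup (X i) x) else lookup (X i) x)

  -- |λ^(0)(F)| = #{ x ∈ ∪X : ε(x) = F }
  lam0 : Subset (suc d) → ℕ
  lam0 F = ΣFin n (λ x → if inUnion x ∧ does (≡-dec B._≟_ (ε x) F) then 1 else 0)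

  -- |λ^(i)(F)|; λ^(i+1)(F) = multiset union of λ^(i)(G) over cofacets G = F ∪ {j}, j ∉ F
  lam : ℕ → Subset (suc d) → ℕ
  lam zero F = lam0 F
  lam (suc i) F = ΣFin (suc d) (λ j → if lookup F j then 0 else lam i (F [ j ]≔ inside))

  -- Vol_i = Σ_{F : dim F ≤ ⌊(d-1)/2⌋ - i} |λ^(i)(F)|.
  -- dim F ≤ ⌊(d-1)/2⌋ - i  ⇔  |F| + i ≤ ⌊(d+1)/2⌋  (valid for all d ≥ 0).
  Vol : ℕ → ℕ
  Vol i = sum (map (λ F → if ∣ F ∣ + i ≤ᵇ ⌊ suc d /2⌋ then lam i F else 0) (allSubsets (suc d)))

edgeFam : {d n : ℕ} → Family d n → Fin (suc d) → Fin (suc d) → Family 1 n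
edgeFam X i j zero = X i
edgeFam X i j (suc zero) = X j

edgeVolSum : {d n : ℕ} → Family d n → ℕ
edgeVolSum {d} X = ΣFin (suc d) (λ i → ΣFin (suc d) (λ j →
  if toℕ i <ᵇ toℕ j then Vol (edgeFam X i j) 1 else 0))

{-# OPTIONS --safe #-}

-- A point x of ∪X lies in λ⁽ⁱ⁾(F) once for each order in which the i elements of ε(x) ∖ F can be
-- added to F, so x contributes the falling factorial K⁽ⁱ⁾ to Vol_i, where K = |ε(x)| is the smaller
-- of deg(x) and d + 1 − deg(x); the dimension bound on F never cuts, because K ≤ ⌊(d+1)/2⌋.
-- An edge {X_i, X_j} contributes x exactly when x lies in just one of X_i, X_j, so the edges
-- contribute deg(x)(d + 1 − deg(x)) = K(d + 1 − K), and pointwise the identity is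
-- d K = K(K − 1) + K(d + 1 − K).

module Submission where

open import Algebra.Properties.CommutativeSemigroup using (interchange; xy∙z≈xz∙y)
open import Data.Bool using (Bool; true; false; if_then_else_; not; _∧_; _xor_)
import Data.Bool as Bool
open import Data.Bool.Properties using (T-≡)
open import Data.Fin using (Fin; zero; suc; toℕ)
open import Data.Fin.Subset using (Subset; inside; outside; ∣_∣)
open import Data.List using (List; []; _∷_; map; allFin; _++_)
open import Data.List.Properties using (map-cong; map-++; map-∘; map-tabulate)
open import Data.Nat using (ℕ; zero; suc; _+_; _*_; _∸_; _≤_; _<_; _≤ᵇ_; _<ᵇ_; ⌊_/2⌋)
open import Data.Nat.Combinatorics.Base using (_P′_)
open import Data.Nat.ListAction using (sum)
open import Data.Nat.ListAction.Properties using (sum-++)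
open import Data.Nat.Properties
open import Data.Vec using ([]; _∷_; lookup; tabulate; _[_]≔_)
open import Data.Vec.Properties using (≡-dec)
open import Function using (_∘_; id; Equivalence)
open import Relation.Nullary using (does; ofʸ; ofⁿ)
open import Relation.Binary.PropositionalEquality
open ≡-Reasoning

open import Defs

private variable
  A B : Set

∑ : List A → (A → ℕ) → ℕ
∑ L f = sum (map f L)

∑-cong : (L : List A) {f g : A → ℕ} → (∀ a → f a ≡ g a) → ∑ L f ≡ ∑ L g
∑-cong L f≗g = cong sum (map-cong f≗g L)

∑-zero : (L : List A) → ∑ L (λ _ → 0) ≡ 0
∑-zero []      = refl
∑-zero (_ ∷ L) = ∑-zero L

∑-+ : (L : List A) (f g : A → ℕ) → ∑ L (λ a → f a + g a) ≡ ∑ L f + ∑ L g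
∑-+ []      f g = refl
∑-+ (a ∷ L) f g = trans (cong (f a + g a +_) (∑-+ L f g))
                        (interchange +-commutativeSemigroup (f a) (g a) (∑ L f) (∑ L g))

*-distribˡ-∑ : (c : ℕ) (L : List A) (f : A → ℕ) → c * ∑ L f ≡ ∑ L (λ a → c * f a)
*-distribˡ-∑ c []      f = *-zeroʳ c
*-distribˡ-∑ c (a ∷ L) f = trans (*-distribˡ-+ c (f a) (∑ L f)) (cong (c * f a +_) (*-distribˡ-∑ c L f))

∑-comm : (L : List A) (M : List B) (h : A → B → ℕ) →
         ∑ L (λ a → ∑ M (h a)) ≡ ∑ M (λ b → ∑ L (λ a → h a b))
∑-comm []      M h = sym (∑-zero M)
∑-comm (a ∷ L) M h = trans (cong (∑ M (h a) +_) (∑-comm L M h)) (sym (∑-+ M (h a) _))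

∑-if-then-0 : (L : List A) (b : Bool) (f : A → ℕ) →
              ∑ L (λ a → if b then f a else 0) ≡ (if b then ∑ L f else 0)
∑-if-then-0 L true  f = refl
∑-if-then-0 L false f = ∑-zero L

∑-++ : (L M : List A) (f : A → ℕ) → ∑ (L ++ M) f ≡ ∑ L f + ∑ M f
∑-++ L M f = trans (cong sum (map-++ f L M)) (sum-++ (map f L) (map f M))

∑-map : (L : List A) (g : A → B) (f : B → ℕ) → ∑ (map g L) f ≡ ∑ L (f ∘ g)
∑-map L g f = cong sum (sym (map-∘ L))

ΣFin-suc : (m : ℕ) (f : Fin (suc m) → ℕ) → ΣFin (suc m) f ≡ f zero + ΣFin m (f ∘ suc)
ΣFin-suc m f = cong (λ l → f zero + sum l) (trans (map-tabulate suc f) (sym (map-tabulate id (f ∘ suc))))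

⟦_⟧ : Bool → ℕ
⟦ b ⟧ = if b then 1 else 0

count : (m : ℕ) → (Fin m → Bool) → ℕ
count m a = ΣFin m (λ i → ⟦ a i ⟧)

count+count-not : (m : ℕ) (a : Fin m → Bool) → count m a + count m (not ∘ a) ≡ m
count+count-not zero    a = refl
count+count-not (suc m) a = begin
  count (suc m) a + count (suc m) (not ∘ a)
    ≡⟨ cong₂ _+_ (ΣFin-suc m (λ i → ⟦ a i ⟧)) (ΣFin-suc m (λ i → ⟦ not (a i) ⟧)) ⟩
  (⟦ a zero ⟧ + count m (a ∘ suc)) + (⟦ not (a zero) ⟧ + count m (not ∘ a ∘ suc))
    ≡⟨ interchange +-commutativeSemigroup ⟦ a zero ⟧ _ ⟦ not (a zero) ⟧ _ ⟩
  (⟦ a zero ⟧ + ⟦ not (a zero) ⟧) + (count m (a ∘ suc) + count m (not ∘ a ∘ suc))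
    ≡⟨ cong₂ _+_ (⟦b⟧+⟦not-b⟧ (a zero)) (count+count-not m (a ∘ suc)) ⟩
  suc m ∎
  where
  ⟦b⟧+⟦not-b⟧ : (b : Bool) → ⟦ b ⟧ + ⟦ not b ⟧ ≡ 1
  ⟦b⟧+⟦not-b⟧ true  = refl
  ⟦b⟧+⟦not-b⟧ false = refl

count-if-not : (m : ℕ) (b : Bool) (a : Fin m → Bool) →
  count m (λ i → if b then not (a i) else a i) ≡ (if b then count m (not ∘ a) else count m a)
count-if-not m true  a = refl
count-if-not m false a = refl

∑-allSubsets-suc : (m : ℕ) (f : Subset (suc m) → ℕ) →
  ∑ (allSubsets (suc m)) f
    ≡ ∑ (allSubsets m) (λ F → f (outside ∷ F)) + ∑ (allSubsets m) (λ F → f (inside ∷ F))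
∑-allSubsets-suc m f = trans (∑-++ (map (outside ∷_) S) (map (inside ∷_) S) f)
  (cong₂ _+_ (∑-map S (outside ∷_) f) (∑-map S (inside ∷_) f))
  where S = allSubsets m

∑-allSubsets-indicator : (m : ℕ) (g : Subset m → ℕ) (E : Subset m) →
  ∑ (allSubsets m) (λ F → g F * ⟦ does (≡-dec Bool._≟_ E F) ⟧) ≡ g E
∑-allSubsets-indicator zero    g []          = trans (+-identityʳ _) (*-identityʳ _)
∑-allSubsets-indicator (suc m) g (false ∷ E) = trans (∑-allSubsets-suc m _) (trans
  (cong₂ _+_ (∑-allSubsets-indicator m (g ∘ (outside ∷_)) E)
             (trans (∑-cong S (λ F → *-zeroʳ (g (inside ∷ F)))) (∑-zero S)))
  (+-identityʳ _))
  where S = allSubsets m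
∑-allSubsets-indicator (suc m) g (true ∷ E)  = trans (∑-allSubsets-suc m _)
  (cong₂ _+_ (trans (∑-cong S (λ F → *-zeroʳ (g (outside ∷ F)))) (∑-zero S))
             (∑-allSubsets-indicator m (g ∘ (inside ∷_)) E))
  where S = allSubsets m

∑-allSubsets-insert : (m : ℕ) (h : Subset m → ℕ) (j : Fin m) →
  ∑ (allSubsets m) (λ F → if lookup F j then 0 else h (F [ j ]≔ inside))
    ≡ ∑ (allSubsets m) (λ G → if lookup G j then h G else 0)
∑-allSubsets-insert (suc m) h zero    = trans (∑-allSubsets-suc m _) (trans
  (+-comm (∑ (allSubsets m) (h ∘ (inside ∷_))) _)
  (sym (∑-allSubsets-suc m _)))
∑-allSubsets-insert (suc m) h (suc j) = trans (∑-allSubsets-suc m _) (trans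
  (cong₂ _+_ (∑-allSubsets-insert m (h ∘ (outside ∷_)) j) (∑-allSubsets-insert m (h ∘ (inside ∷_)) j))
  (sym (∑-allSubsets-suc m _)))

∣tabulate∣ : (m : ℕ) (a : Fin m → Bool) → ∣ tabulate a ∣ ≡ count m a
∣tabulate∣ zero    a = refl
∣tabulate∣ (suc m) a = trans (head (a zero)) (sym (ΣFin-suc m (λ i → ⟦ a i ⟧)))
  where
  head : (b : Bool) → ∣ b ∷ tabulate (a ∘ suc) ∣ ≡ ⟦ b ⟧ + count m (a ∘ suc)
  head true  = cong suc (∣tabulate∣ m (a ∘ suc))
  head false = ∣tabulate∣ m (a ∘ suc)

∣[]≔inside∣ : {m : ℕ} (F : Subset m) (j : Fin m) → lookup F j ≡ false →
              ∣ F [ j ]≔ inside ∣ ≡ suc ∣ F ∣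
∣[]≔inside∣ (false ∷ F) zero    _   = refl
∣[]≔inside∣ (false ∷ F) (suc j) j∉F = ∣[]≔inside∣ F j j∉F
∣[]≔inside∣ (true ∷ F)  (suc j) j∉F = cong suc (∣[]≔inside∣ F j j∉F)

ΣFin-if-lookup : {m : ℕ} (G : Subset m) (c : ℕ) → ΣFin m (λ j → if lookup G j then c else 0) ≡ c * ∣ G ∣
ΣFin-if-lookup []                  c = sym (*-zeroʳ c)
ΣFin-if-lookup {suc m} (false ∷ G) c =
  trans (ΣFin-suc m (λ j → if lookup (false ∷ G) j then c else 0)) (ΣFin-if-lookup G c)
ΣFin-if-lookup {suc m} (true ∷ G)  c = begin
  ΣFin (suc m) (λ j → if lookup (true ∷ G) j then c else 0) ≡⟨ ΣFin-suc m _ ⟩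
  c + ΣFin m (λ j → if lookup G j then c else 0)           ≡⟨ cong (c +_) (ΣFin-if-lookup G c) ⟩
  c + c * ∣ G ∣                                              ≡⟨ *-suc c ∣ G ∣ ⟨
  c * suc ∣ G ∣                                              ∎

-- lam X (suc i) is definitionally climb (lam X i), and chains i E F counts the orders in which
-- i elements can be added to F one at a time so as to reach E.
climb : {m : ℕ} → (Subset m → ℕ) → Subset m → ℕ
climb {m} h F = ΣFin m (λ j → if lookup F j then 0 else h (F [ j ]≔ inside))

chains : {m : ℕ} → ℕ → Subset m → Subset m → ℕ
chains zero    E F = ⟦ does (≡-dec Bool._≟_ E F) ⟧
chains (suc i) E   = climb (chains i E)

climb-cong : {m : ℕ} {h h′ : Subset m → ℕ} → (∀ G → h G ≡ h′ G) → ∀ F → climb h F ≡ climb h′ F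
climb-cong {m} h≗h′ F = ∑-cong (allFin m) (λ j → cong (λ t → if lookup F j then 0 else t) (h≗h′ _))

climb-∑ : {m : ℕ} (L : List A) (h : A → Subset m → ℕ) (F : Subset m) →
  climb (λ G → ∑ L (λ a → h a G)) F ≡ ∑ L (λ a → climb (h a) F)
climb-∑ {m = m} L h F = trans (∑-cong (allFin m) push) (∑-comm (allFin m) L _)
  where
  push : ∀ j → (if lookup F j then 0 else ∑ L (λ a → h a (F [ j ]≔ inside)))
               ≡ ∑ L (λ a → if lookup F j then 0 else h a (F [ j ]≔ inside))
  push j with lookup F j
  ... | true  = sym (∑-zero L)
  ... | false = refl

climb-zero : {m : ℕ} (F : Subset m) → climb (λ _ → 0) F ≡ 0
climb-zero {m} F = trans (∑-cong (allFin m) (λ j → if-same (lookup F j))) (∑-zero (allFin m))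
  where
  if-same : (b : Bool) → (if b then 0 else 0) ≡ 0
  if-same true  = refl
  if-same false = refl

-- Double counting of the pairs (F , j) with j ∉ F through G = F ∪ {j}.
∑-climb : (m : ℕ) (g : ℕ → ℕ) (h : Subset m → ℕ) →
  ∑ (allSubsets m) (λ F → g (suc ∣ F ∣) * climb h F) ≡ ∑ (allSubsets m) (λ G → g ∣ G ∣ * h G * ∣ G ∣)
∑-climb m g h = begin
  ∑ S (λ F → g (suc ∣ F ∣) * climb h F)
    ≡⟨ ∑-cong S (λ F → trans (*-distribˡ-∑ (g (suc ∣ F ∣)) (allFin m) _) (∑-cong (allFin m) (weigh F))) ⟩
  ∑ S (λ F → ΣFin m (λ j → if lookup F j then 0 else k (F [ j ]≔ inside)))
    ≡⟨ ∑-comm S (allFin m) _ ⟩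
  ΣFin m (λ j → ∑ S (λ F → if lookup F j then 0 else k (F [ j ]≔ inside)))
    ≡⟨ ∑-cong (allFin m) (∑-allSubsets-insert m k) ⟩
  ΣFin m (λ j → ∑ S (λ G → if lookup G j then k G else 0))
    ≡⟨ ∑-comm (allFin m) S _ ⟩
  ∑ S (λ G → ΣFin m (λ j → if lookup G j then k G else 0))
    ≡⟨ ∑-cong S (λ G → ΣFin-if-lookup G (k G)) ⟩
  ∑ S (λ G → k G * ∣ G ∣) ∎
  where
  S = allSubsets m
  k : Subset m → ℕ
  k G = g ∣ G ∣ * h G
  weigh : ∀ F j → g (suc ∣ F ∣) * (if lookup F j then 0 else h (F [ j ]≔ inside))
                  ≡ (if lookup F j then 0 else k (F [ j ]≔ inside))
  weigh F j with lookup F j in j∉F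
  ... | true  = *-zeroʳ (g (suc ∣ F ∣))
  ... | false = cong (λ t → g t * h (F [ j ]≔ inside)) (sym (∣[]≔inside∣ F j j∉F))

-- n P′ i is the falling factorial n (n − 1) ⋯ (n − i + 1); thanks to truncated subtraction it is
-- also correct, namely 0, when i > n.
∑-chains : (m i : ℕ) (g : ℕ → ℕ) (E : Subset m) →
  ∑ (allSubsets m) (λ F → g (∣ F ∣ + i) * chains i E F) ≡ g ∣ E ∣ * (∣ E ∣ P′ i)
∑-chains m zero    g E = begin
  ∑ S (λ F → g (∣ F ∣ + 0) * chains 0 E F)
    ≡⟨ ∑-cong S (λ F → cong (λ t → g t * chains 0 E F) (+-identityʳ ∣ F ∣)) ⟩
  ∑ S (λ F → g ∣ F ∣ * chains 0 E F)
    ≡⟨ ∑-allSubsets-indicator m (g ∘ ∣_∣) E ⟩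
  g ∣ E ∣
    ≡⟨ *-identityʳ _ ⟨
  g ∣ E ∣ * 1 ∎
  where S = allSubsets m
∑-chains m (suc i) g E = begin
  ∑ S (λ F → g (∣ F ∣ + suc i) * climb (chains i E) F)
    ≡⟨ ∑-cong S (λ F → cong (λ t → g t * climb (chains i E) F) (+-suc ∣ F ∣ i)) ⟩
  ∑ S (λ F → g (suc ∣ F ∣ + i) * climb (chains i E) F)
    ≡⟨ ∑-climb m (λ t → g (t + i)) (chains i E) ⟩
  ∑ S (λ G → g (∣ G ∣ + i) * chains i E G * ∣ G ∣)
    ≡⟨ ∑-cong S (λ G → trans (xy∙z≈xz∙y *-commutativeSemigroup (g (∣ G ∣ + i)) (chains i E G) ∣ G ∣)
                             (cong (λ t → g (∣ G ∣ + i) * t * chains i E G) (sym (m+n∸n≡m ∣ G ∣ i)))) ⟩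
  ∑ S (λ G → g′ (∣ G ∣ + i) * chains i E G)
    ≡⟨ ∑-chains m i g′ E ⟩
  g ∣ E ∣ * (∣ E ∣ ∸ i) * (∣ E ∣ P′ i)
    ≡⟨ *-assoc (g ∣ E ∣) _ _ ⟩
  g ∣ E ∣ * (∣ E ∣ P′ suc i) ∎
  where
  S = allSubsets m
  g′ : ℕ → ℕ
  g′ t = g t * (t ∸ i)

smaller-side-doubled-≤ : ∀ N D Z → D + Z ≡ N →
  let K = if N <ᵇ 2 * D then Z else D in K + K ≤ N
smaller-side-doubled-≤ N D Z D+Z≡N with N <ᵇ 2 * D | <ᵇ-reflects-< N (2 * D)
... | true  | ofʸ N<2D = subst (Z + Z ≤_) D+Z≡N (+-monoˡ-≤ Z (<⇒≤ Z<D))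
  where
  Z<D : Z < D
  Z<D = +-cancelˡ-< D Z D (subst₂ _<_ (sym D+Z≡N) (cong (D +_) (+-identityʳ D)) N<2D)
... | false | ofⁿ N≮2D = subst (_≤ N) (cong (D +_) (+-identityʳ D)) (≮⇒≥ N≮2D)

≤-half : ∀ {k N} → k + k ≤ N → k ≤ ⌊ N /2⌋
≤-half {k} k+k≤N = subst (_≤ _) (sym (n≡⌊n+n/2⌋ k)) (⌊n/2⌋-mono k+k≤N)

0P′suc : ∀ i → 0 P′ suc i ≡ 0
0P′suc i = cong (_* (0 P′ i)) (0∸n≡0 i)

P′-complement : ∀ d K K′ → K + K′ ≡ suc d → d * (K P′ 1) ≡ K P′ 2 + K * K′
P′-complement d zero      K′ _     = *-zeroʳ d
P′-complement d (suc k) K′ k+K′≡d = begin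
  d * (suc k * 1)               ≡⟨ cong (_* (suc k * 1)) (sym (suc-injective k+K′≡d)) ⟩
  (k + K′) * (suc k * 1)        ≡⟨ *-distribʳ-+ (suc k * 1) k K′ ⟩
  k * (suc k * 1) + K′ * (suc k * 1) ≡⟨ cong (λ t → k * (suc k * 1) + K′ * t) (*-identityʳ (suc k)) ⟩
  k * (suc k * 1) + K′ * suc k  ≡⟨ cong (k * (suc k * 1) +_) (*-comm K′ (suc k)) ⟩
  k * (suc k * 1) + suc k * K′  ∎

P′-smaller-side : ∀ d D Z → D + Z ≡ suc d → (b : Bool) →
  let K = if b then Z else D in d * (K P′ 1) ≡ K P′ 2 + D * Z
P′-smaller-side d D Z D+Z≡1+d true  =
  trans (P′-complement d Z D (trans (+-comm Z D) D+Z≡1+d)) (cong (Z P′ 2 +_) (*-comm Z D))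
P′-smaller-side d D Z D+Z≡1+d false = P′-complement d D Z D+Z≡1+d

∑-pairs-xor : (m : ℕ) (a : Fin m → Bool) →
  ΣFin m (λ i → ΣFin m (λ j → if toℕ i <ᵇ toℕ j then ⟦ a i xor a j ⟧ else 0))
    ≡ count m a * count m (not ∘ a)
∑-pairs-xor zero    a = refl
∑-pairs-xor (suc m) a = begin
  ΣFin (suc m) (λ i → ΣFin (suc m) (λ j → pair i j))
    ≡⟨ ΣFin-suc m _ ⟩
  ΣFin (suc m) (pair zero) + ΣFin m (λ i → ΣFin (suc m) (pair (suc i)))
    ≡⟨ cong₂ _+_ (ΣFin-suc m (pair zero)) (∑-cong (allFin m) (λ i → ΣFin-suc m (pair (suc i)))) ⟩
  ΣFin m (λ j → ⟦ a zero xor a (suc j) ⟧)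
    + ΣFin m (λ i → ΣFin m (λ j → if toℕ i <ᵇ toℕ j then ⟦ a (suc i) xor a (suc j) ⟧ else 0))
    ≡⟨ cong (ΣFin m (λ j → ⟦ a zero xor a (suc j) ⟧) +_) (∑-pairs-xor m (a ∘ suc)) ⟩
  ΣFin m (λ j → ⟦ a zero xor a (suc j) ⟧) + D * Z
    ≡⟨ first-row (a zero) ⟩
  (⟦ a zero ⟧ + D) * (⟦ not (a zero) ⟧ + Z)
    ≡⟨ cong₂ _*_ (ΣFin-suc m (λ i → ⟦ a i ⟧)) (ΣFin-suc m (λ i → ⟦ not (a i) ⟧)) ⟨
  count (suc m) a * count (suc m) (not ∘ a) ∎
  where
  pair : Fin (suc m) → Fin (suc m) → ℕ
  pair i j = if toℕ i <ᵇ toℕ j then ⟦ a i xor a j ⟧ else 0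
  D Z : ℕ
  D = count m (a ∘ suc)
  Z = count m (not ∘ a ∘ suc)
  first-row : (b : Bool) → ΣFin m (λ j → ⟦ b xor a (suc j) ⟧) + D * Z ≡ (⟦ b ⟧ + D) * (⟦ not b ⟧ + Z)
  first-row true  = refl
  first-row false = sym (*-suc D Z)

-- For d = 1 the degree and codegree of a point unfold to D and Z below.
edge-weight : (b₀ b₁ : Bool) →
  let D = ⟦ b₀ ⟧ + (⟦ b₁ ⟧ + 0)
      Z = ⟦ not b₀ ⟧ + (⟦ not b₁ ⟧ + 0)
  in (if 2 <ᵇ 2 * D then Z else D) P′ 1 ≡ ⟦ b₀ xor b₁ ⟧
edge-weight true  true  = refl
edge-weight true  false = refl
edge-weight false true  = refl
edge-weight false false = refl

module _ {d n : ℕ} (X : Family d n) where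

  column : Fin n → Fin (suc d) → Bool
  column x i = lookup (X i) x

  codeg : Fin n → ℕ
  codeg x = count (suc d) (not ∘ column x)

  admissible : ℕ → ℕ
  admissible t = ⟦ t ≤ᵇ ⌊ suc d /2⌋ ⟧

  lam-chains : ∀ i F → lam X i F ≡ ΣFin n (λ x → if inUnion X x then chains i (ε X x) F else 0)
  lam-chains zero    F = ∑-cong (allFin n) (λ x → ⟦∧⟧ (inUnion X x) _)
    where
    ⟦∧⟧ : (b c : Bool) → ⟦ b ∧ c ⟧ ≡ (if b then ⟦ c ⟧ else 0)
    ⟦∧⟧ true  c = refl
    ⟦∧⟧ false c = refl
  lam-chains (suc i) F = begin
    climb (lam X i) F                        ≡⟨ climb-cong (lam-chains i) F ⟩
    climb (λ G → ΣFin n (λ x → h x G)) F     ≡⟨ climb-∑ (allFin n) h F ⟩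
    ΣFin n (λ x → climb (h x) F)             ≡⟨ ∑-cong (allFin n) climb-h ⟩
    ΣFin n (λ x → if inUnion X x then chains (suc i) (ε X x) F else 0) ∎
    where
    h : Fin n → Subset (suc d) → ℕ
    h x G = if inUnion X x then chains i (ε X x) G else 0
    climb-h : ∀ x → climb (h x) F ≡ (if inUnion X x then chains (suc i) (ε X x) F else 0)
    climb-h x with inUnion X x
    ... | true  = refl
    ... | false = climb-zero F

  Vol≡∑ : ∀ i →
    Vol X i ≡ ΣFin n (λ x → if inUnion X x then admissible ∣ ε X x ∣ * (∣ ε X x ∣ P′ i) else 0)
  Vol≡∑ i = begin
    ∑ S (λ F → if ∣ F ∣ + i ≤ᵇ ⌊ suc d /2⌋ then lam X i F else 0)
      ≡⟨ ∑-cong S (λ F → if-then-0 (∣ F ∣ + i ≤ᵇ ⌊ suc d /2⌋) (lam X i F)) ⟩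
    ∑ S (λ F → w F * lam X i F)
      ≡⟨ ∑-cong S (λ F → trans (cong (w F *_) (lam-chains i F)) (*-distribˡ-∑ (w F) (allFin n) _)) ⟩
    ∑ S (λ F → ΣFin n (λ x → w F * h x F))
      ≡⟨ ∑-comm S (allFin n) _ ⟩
    ΣFin n (λ x → ∑ S (λ F → w F * h x F))
      ≡⟨ ∑-cong (allFin n) ∑-w*h ⟩
    ΣFin n (λ x → if inUnion X x then admissible ∣ ε X x ∣ * (∣ ε X x ∣ P′ i) else 0) ∎
    where
    S = allSubsets (suc d)
    w : Subset (suc d) → ℕ
    w F = admissible (∣ F ∣ + i)
    h : Fin n → Subset (suc d) → ℕ
    h x F = if inUnion X x then chains i (ε X x) F else 0
    if-then-0 : (b : Bool) (c : ℕ) → (if b then c else 0) ≡ ⟦ b ⟧ * c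
    if-then-0 true  c = sym (+-identityʳ c)
    if-then-0 false c = refl
    ∑-w*h : ∀ x → ∑ S (λ F → w F * h x F)
                ≡ (if inUnion X x then admissible ∣ ε X x ∣ * (∣ ε X x ∣ P′ i) else 0)
    ∑-w*h x with inUnion X x
    ... | true  = ∑-chains (suc d) i admissible (ε X x)
    ... | false = trans (∑-cong S (λ F → *-zeroʳ (w F))) (∑-zero S)

  ∣ε∣≡smaller-side : ∀ x → ∣ ε X x ∣ ≡ (if suc d <ᵇ 2 * deg X x then codeg x else deg X x)
  ∣ε∣≡smaller-side x =
    trans (∣tabulate∣ (suc d) (λ i → if isMaj X x then not (column x i) else column x i))
          (count-if-not (suc d) (isMaj X x) (column x))

  ∣ε∣≤half : ∀ x → ∣ ε X x ∣ ≤ ⌊ suc d /2⌋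
  ∣ε∣≤half x = ≤-half (subst (λ K → K + K ≤ suc d) (sym (∣ε∣≡smaller-side x))
    (smaller-side-doubled-≤ (suc d) (deg X x) (codeg x) (count+count-not (suc d) (column x))))

  Vol-suc≡∑ : ∀ i → Vol X (suc i) ≡ ΣFin n (λ x → ∣ ε X x ∣ P′ suc i)
  Vol-suc≡∑ i = trans (Vol≡∑ (suc i)) (∑-cong (allFin n) drop-guards)
    where
    drop-guards : ∀ x →
      (if inUnion X x then admissible ∣ ε X x ∣ * (∣ ε X x ∣ P′ suc i) else 0) ≡ ∣ ε X x ∣ P′ suc i
    drop-guards x with inUnion X x in x∈∪X
    ... | true  = trans (cong (_* (∣ ε X x ∣ P′ suc i)) admissible-∣ε∣) (*-identityˡ _)
      where
      admissible-∣ε∣ : admissible ∣ ε X x ∣ ≡ 1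
      admissible-∣ε∣ rewrite Equivalence.to T-≡ (≤⇒≤ᵇ (∣ε∣≤half x)) = refl
    ... | false = sym (trans (cong (_P′ suc i) ∣ε∣≡0) (0P′suc i))
      where
      1≰ᵇ⇒≡0 : ∀ {k} → (1 ≤ᵇ k) ≡ false → k ≡ 0
      1≰ᵇ⇒≡0 {zero} _ = refl
      ∣ε∣≡0 : ∣ ε X x ∣ ≡ 0
      ∣ε∣≡0 = trans (∣ε∣≡smaller-side x)
                    (cong (λ D → if suc d <ᵇ 2 * D then codeg x else D) (1≰ᵇ⇒≡0 {deg X x} x∈∪X))

  d*∣ε∣≡∣ε∣P′2+deg*codeg : ∀ x → d * (∣ ε X x ∣ P′ 1) ≡ ∣ ε X x ∣ P′ 2 + deg X x * codeg x
  d*∣ε∣≡∣ε∣P′2+deg*codeg x =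
    subst (λ K → d * (K P′ 1) ≡ K P′ 2 + deg X x * codeg x) (sym (∣ε∣≡smaller-side x))
          (P′-smaller-side d (deg X x) (codeg x) (count+count-not (suc d) (column x)) (isMaj X x))

Vol-edge≡∑xor : {n : ℕ} (Y : Family 1 n) →
  Vol Y 1 ≡ ΣFin n (λ x → ⟦ column Y x zero xor column Y x (suc zero) ⟧)
Vol-edge≡∑xor {n} Y = trans (Vol-suc≡∑ Y 0) (∑-cong (allFin n) (λ x →
  trans (cong (_P′ 1) (∣ε∣≡smaller-side Y x)) (edge-weight (column Y x zero) (column Y x (suc zero)))))

edgeVolSum≡∑deg*codeg : {d n : ℕ} (X : Family d n) → edgeVolSum X ≡ ΣFin n (λ x → deg X x * codeg X x)
edgeVolSum≡∑deg*codeg {d} {n} X = begin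
  ΣFin (suc d) (λ i → ΣFin (suc d) (λ j → if toℕ i <ᵇ toℕ j then Vol (edgeFam X i j) 1 else 0))
    ≡⟨ ∑-cong V (λ i → ∑-cong V (λ j → trans
         (cong (λ t → if toℕ i <ᵇ toℕ j then t else 0) (Vol-edge≡∑xor (edgeFam X i j)))
         (sym (∑-if-then-0 (allFin n) (toℕ i <ᵇ toℕ j) (λ x → ⟦ column X x i xor column X x j ⟧))))) ⟩
  ΣFin (suc d) (λ i → ΣFin (suc d) (λ j → ΣFin n (λ x → pair x i j)))
    ≡⟨ ∑-cong V (λ i → ∑-comm V (allFin n) (λ j x → pair x i j)) ⟩
  ΣFin (suc d) (λ i → ΣFin n (λ x → ΣFin (suc d) (pair x i)))
    ≡⟨ ∑-comm V (allFin n) _ ⟩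
  ΣFin n (λ x → ΣFin (suc d) (λ i → ΣFin (suc d) (pair x i)))
    ≡⟨ ∑-cong (allFin n) (λ x → ∑-pairs-xor (suc d) (column X x)) ⟩
  ΣFin n (λ x → deg X x * codeg X x) ∎
  where
  V = allFin (suc d)
  pair : Fin n → Fin (suc d) → Fin (suc d) → ℕ
  pair x i j = if toℕ i <ᵇ toℕ j then ⟦ column X x i xor column X x j ⟧ else 0

theorem4p1 : (d n : ℕ) → 1 ≤ d → (X : Family d n) →
    d * Vol X 1 ≡ Vol X 2 + edgeVolSum X
-- The identity also holds for d = 0.
theorem4p1 d n _ X = begin
  d * Vol X 1                            ≡⟨ cong (d *_) (Vol-suc≡∑ X 0) ⟩
  d * ΣFin n (λ x → ∣ ε X x ∣ P′ 1)      ≡⟨ *-distribˡ-∑ d (allFin n) _ ⟩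
  ΣFin n (λ x → d * (∣ ε X x ∣ P′ 1))
    ≡⟨ ∑-cong (allFin n) (d*∣ε∣≡∣ε∣P′2+deg*codeg X) ⟩
  ΣFin n (λ x → ∣ ε X x ∣ P′ 2 + deg X x * codeg X x)
    ≡⟨ ∑-+ (allFin n) _ _ ⟩
  ΣFin n (λ x → ∣ ε X x ∣ P′ 2) + ΣFin n (λ x → deg X x * codeg X x)
    ≡⟨ cong₂ _+_ (Vol-suc≡∑ X 1) (edgeVolSum≡∑deg*codeg X) ⟨
  Vol X 2 + edgeVolSum X ∎
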